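{- Let $D=(V,E)$ be a directed graph without loops, with vertex set $V=\{1,\ldots,n\}$ and at least one edge, and let $S\subseteq V$. Let $M$ be the incidence matrix of $D$ (rows indexed by vertices, columns by edges) and let $M(S)$ be the generalized incidence matrix for $D$ and $S$. Then the rows of $M(S)$ (i.e., the vertices) and the columns of $M$ (i.e., the edges) can be ordered so that the resulting matrix $M(S)$ (with the unit columns for $S$ placed first) is a sign-restricted matrix if and only if both of the following hold: (i) $D$ is acyclic; (ii) $d^-(v)-d^+(v)\le 1$ for every vertex $v$, and if $d^-(v)=d^+(v)+1$ for some vertex $v$ then $v\in S$.
   Context: A sign-restricted matrix (SRM) is a matrix $A=[a_{ij}]$ with entries in $\{0,1,-1\}$ such that every partial column sum $\sum_{k=1}^{i} a_{kj}$ equals $0$ or $1$, and every partial row sum $\sum_{l=1}^{j} a_{il}$ is nonnegative. The incidence matrix $M$ of $D$ has, in the column corresponding to the edge $(i,j)$, a $1$ in row $i$, a $-1$ in row $j$, and zeros elsewhere. The generalized incidence matrix $M(S)$ is obtained from $M$ by adjoining, before all columns of $M$, the distinct unit column vectors $e_v$ for $v\in S$ (a $1$ in row $v$, zeros elsewhere). $d^+(v)$ (resp. $d^-(v)$) is the number of edges of $D$ with tail (resp. head) $v$. -}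

module Defs where

open import Data.Nat using (ℕ; zero; suc)
open import Data.Integer using (ℤ; +_; -_; _+_; _≤_; 0ℤ; 1ℤ)
open import Data.Fin using (Fin; zero; suc)
open import Data.Fin.Permutation using (Permutation′; _⟨$⟩ʳ_)
open import Data.Product using (_×_; _,_; proj₁; proj₂)
open import Data.Sum using (_⊎_)
open import Data.List using (List; []; _∷_; length; filter; map; _++_; lookup)
open import Data.List.Membership.Propositional using (_∈_)
open import Relation.Binary.PropositionalEquality using (_≡_)
open import Relation.Nullary using (¬_; yes; no)
open import Data.Fin using (_≟_)

-- A directed graph on vertex set Fin n, given by its list of edges (i , j)
Edge : ℕ → Set
Edge n = Fin n × Fin n

-- sum of the first i entries of a vector (f 0 + ... + f (i-1)), truncated at its length
sumFirst : ∀ {m} → ℕ → (Fin m → ℤ) → ℤ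
sumFirst zero    f = 0ℤ
sumFirst {zero}  (suc i) f = 0ℤ
sumFirst {suc m} (suc i) f = f zero + sumFirst i (λ k → f (suc k))

record IsSRM {m k : ℕ} (A : Fin m → Fin k → ℤ) : Set where
  field
    entries : ∀ r c → (A r c ≡ 0ℤ) ⊎ ((A r c ≡ 1ℤ) ⊎ (A r c ≡ - 1ℤ))
    colSums : ∀ c (i : ℕ) → (sumFirst i (λ r → A r c) ≡ 0ℤ) ⊎ (sumFirst i (λ r → A r c) ≡ 1ℤ)
    rowSums : ∀ r (j : ℕ) → 0ℤ ≤ sumFirst j (λ c → A r c)

Column : ℕ → Set
Column n = Fin n → ℤ

unitCol : ∀ {n} → Fin n → Column n
unitCol v k with k ≟ v
... | yes _ = 1ℤ
... | no  _ = 0ℤ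

edgeCol : ∀ {n} → Edge n → Column n
edgeCol (i , j) k with k ≟ i | k ≟ j
... | yes _ | _     = 1ℤ
... | no _  | yes _ = - 1ℤ
... | no _  | no _  = 0ℤ

-- the generalized incidence matrix M(S) with unit columns listed in `ss`
-- (placed first), edge columns in the order `es`, and rows ordered by the
-- permutation σ (row r of the new matrix is vertex σ r).
genIncMatrix : ∀ {n} → Permutation′ n → (ss : List (Fin n)) → (es : List (Edge n))
             → Fin n → Fin (length (map unitCol ss ++ map edgeCol es)) → ℤ
genIncMatrix σ ss es r c = lookup (map unitCol ss ++ map edgeCol es) c (σ ⟨$⟩ʳ r)

outdeg : ∀ {n} → List (Edge n) → Fin n → ℕ
outdeg es v = length (filter (λ e → proj₁ e ≟ v) es)

indeg : ∀ {n} → List (Edge n) → Fin n → ℕ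
indeg es v = length (filter (λ e → proj₂ e ≟ v) es)

data Reach⁺ {n} (es : List (Edge n)) : Fin n → Fin n → Set where
  step : ∀ {u v} → (u , v) ∈ es → Reach⁺ es u v
  _∷ʳ_ : ∀ {u w v} → (u , w) ∈ es → Reach⁺ es w v → Reach⁺ es u v

Acyclic : ∀ {n} → List (Edge n) → Set
Acyclic es = ∀ v → ¬ Reach⁺ es v v

-- The column of an edge has its +1 in the row of the
-- tail and its -1 in the row of the head, so its prefix sums stay in {0, 1} iff the tail
-- comes first: admissible row orders are exactly the topological orders of D, which exist
-- iff D is acyclic. The row of v sums to [v ∈ S] + d⁺(v) - d⁻(v), which is ≥ 0 iff v meets
-- condition (ii). Conversely, listing the edge columns by decreasing row of their tails puts
-- every +1 of a row before its -1s, so each prefix sum of the row is ≥ 0 or ≥ the row total.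
module Submission where

open import Defs
open import Data.Nat as ℕ using (ℕ; zero; suc; z≤n; s≤s; z<s; s<s)
import Data.Nat.Properties as ℕ
open import Data.Integer as ℤ using (ℤ; +_; -_; 0ℤ; 1ℤ; +≤+; -≤+)
import Data.Integer.Properties as ℤ
open import Data.Integer.Tactic.RingSolver using (solve-∀)
open import Data.Fin as Fin using (Fin; zero; suc; toℕ; _<_; _≟_)
import Data.Fin.Properties as Fin
open import Data.Fin.Subset using (Subset) renaming (_∈_ to _∈ₛ_)
open import Data.Fin.Subset.Properties using () renaming (_∈?_ to _∈ₛ?_)
open import Data.Fin.Permutation
  using (Permutation; Permutation′; permutation; _⟨$⟩ʳ_; _⟨$⟩ˡ_; inverseˡ; inverseʳ; ↔⇒≡)
open import Data.Product using (Σ; ∃-syntax; _×_; _,_; proj₁; proj₂)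
open import Data.Sum using (_⊎_; inj₁; inj₂; [_,_])
open import Data.List using (List; []; _∷_; _++_; foldr; map; filter; take; length; lookup; allFin)
open import Data.List.Properties using (map-++; map-∘; length-map; take-all)
open import Data.List.Relation.Unary.All as All using (All; []; _∷_)
import Data.List.Relation.Unary.All.Properties as All
open import Data.List.Relation.Unary.Any as Any using (here; there; any?)
open import Data.List.Relation.Unary.Any.Properties using (lookup-index)
open import Data.List.Relation.Unary.AllPairs using (AllPairs; []; _∷_)
open import Data.List.Relation.Unary.Unique.Propositional using (Unique)
import Data.List.Relation.Unary.Unique.Propositional.Properties as Unique
open import Data.List.Relation.Unary.Sorted.TotalOrder.Properties using (Sorted⇒AllPairs)
open import Data.List.Membership.Propositional using (_∈_; _∉_; find; lose)
open import Data.List.Membership.Propositional.Properties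
  using (∈-lookup; ∈-++⁻; ∈-++⁺ʳ; ∈-map⁺; ∈-map⁻; ∈-filter⁺; ∈-filter⁻; ∈-allFin)
open import Data.List.Membership.DecPropositional using () renaming (_∈?_ to ∈?[_])
open import Data.List.Relation.Binary.Permutation.Propositional using (_↭_; ↭-sym)
open import Data.List.Relation.Binary.Permutation.Propositional.Properties
  using (∈-resp-↭; All-resp-↭; ↭-length; filter-↭)
open import Function using (_∘_; id)
open import Function.Bundles using (_⇔_; mk⇔; Equivalence)
import Function.Properties.Equivalence as ⇔
open import Level using (0ℓ)
open import Relation.Binary.Bundles using (DecTotalOrder)
open import Relation.Binary.Definitions using (tri<; tri≈; tri>)
import Relation.Binary.Construct.On as On
import Relation.Binary.Construct.Flip.EqAndOrd as Flip
open import Relation.Binary.PropositionalEquality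
  using (_≡_; _≢_; refl; sym; trans; cong; cong₂; cong-app; subst; module ≡-Reasoning)
open import Relation.Nullary using (¬_; Dec; yes; no; ¬?; contradiction)
open import Relation.Nullary.Decidable using (_×-dec_; decidable-stable)

private
  variable
    m n : ℕ
    x : ℤ
    xs ys : List ℤ

lookup-injective : ∀ {A : Set} {xs : List A} → Unique xs → ∀ i j → lookup xs i ≡ lookup xs j → i ≡ j
lookup-injective (_ ∷ _)      zero    zero    _  = refl
lookup-injective (x∉xs ∷ _)   zero    (suc j) eq = contradiction eq (All.lookup x∉xs (∈-lookup j))
lookup-injective (x∉xs ∷ _)   (suc i) zero    eq = contradiction (sym eq) (All.lookup x∉xs (∈-lookup i))
lookup-injective (_ ∷ unique) (suc i) (suc j) eq = cong suc (lookup-injective unique i j eq)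

-- Topological orders

-- Row r of genIncMatrix σ holds vertex σ ⟨$⟩ʳ r, so σ ⟨$⟩ˡ v is the row of v.
Topological : ∀ {m n} → List (Edge n) → Permutation m n → Set
Topological E σ = ∀ {u w} → (u , w) ∈ E → σ ⟨$⟩ˡ u < σ ⟨$⟩ˡ w

module _ {n} {E : List (Edge n)} where

  reach-snoc : ∀ {u w v} → Reach⁺ E u w → (w , v) ∈ E → Reach⁺ E u v
  reach-snoc (step e)    e′ = e ∷ʳ step e′
  reach-snoc (e ∷ʳ path) e′ = e ∷ʳ reach-snoc path e′

  Reach⁺⇒< : ∀ {m} (σ : Permutation m n) → Topological E σ →
             ∀ {u w} → Reach⁺ E u w → σ ⟨$⟩ˡ u < σ ⟨$⟩ˡ w
  Reach⁺⇒< σ topo (step e)    = topo e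
  Reach⁺⇒< σ topo (e ∷ʳ path) = ℕ.<-trans (topo e) (Reach⁺⇒< σ topo path)

  topological⇒acyclic : ∀ {m} (σ : Permutation m n) → Topological E σ → Acyclic E
  topological⇒acyclic σ topo v cycle = ℕ.<-irrefl refl (Reach⁺⇒< σ topo cycle)

  private
    module Walk (P : Fin n → Set) (next : ∀ {u} → P u → ∃[ w ] ((u , w) ∈ E × P w)) {v} (Pv : P v) where
      walk : ℕ → Σ (Fin n) P
      walk zero    = v , Pv
      walk (suc k) = let (w , _ , Pw) = next (proj₂ (walk k)) in w , Pw

      vertex : ℕ → Fin n
      vertex k = proj₁ (walk k)

      edge : ∀ k → (vertex k , vertex (suc k)) ∈ E
      edge k = proj₁ (proj₂ (next (proj₂ (walk k))))

      path : ∀ {i j} → i ℕ.< j → Reach⁺ E (vertex i) (vertex j)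
      path {i} {suc j} (s≤s i≤j) with ℕ.m≤n⇒m<n∨m≡n i≤j
      ... | inj₁ i<j  = reach-snoc (path i<j) (edge j)
      ... | inj₂ refl = step (edge i)

  -- A walk that never leaves P must, by pigeonhole, revisit a vertex.
  acyclic⇒no-endless-walk : Acyclic E → (P : Fin n → Set) →
                            (∀ {u} → P u → ∃[ w ] ((u , w) ∈ E × P w)) → ∀ {v} → ¬ P v
  acyclic⇒no-endless-walk acyclic P next Pv =
    let i , j , i<j , same = Fin.pigeonhole (ℕ.n<1+n n) (λ (k : Fin (suc n)) → vertex (toℕ k))
    in  acyclic _ (subst (Reach⁺ E (vertex (toℕ i))) (sym same) (path i<j))
    where open Walk P next Pv

  Closed : List (Fin n) → Fin n → Set
  Closed R u = ∀ {w} → (u , w) ∈ E → w ∈ R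

  data TopologicalList : List (Fin n) → Set where
    []   : TopologicalList []
    cons : ∀ {v R} → Closed R v → v ∉ R → TopologicalList R → TopologicalList (v ∷ R)

  closed-or-successor-outside : ∀ R u → Closed R u ⊎ ∃[ w ] ((u , w) ∈ E × w ∉ R)
  closed-or-successor-outside R u
    with any? (λ e → (proj₁ e ≟ u) ×-dec ¬? (∈?[ _≟_ ] (proj₂ e) R)) E
  ... | yes found with find found
  ...   | (_ , w) , e , refl , w∉R = inj₂ (w , e , w∉R)
  closed-or-successor-outside R u | no none =
    inj₁ λ {w} e → decidable-stable (∈?[ _≟_ ] w R) (λ w∉R → none (lose e (refl , w∉R)))

  closed? : ∀ R u → Dec (Closed R u)
  closed? R u with closed-or-successor-outside R u
  ... | inj₁ closed          = yes closed
  ... | inj₂ (_ , e , w∉R) = no λ closed → w∉R (closed e)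

  closed-vertex-outside : Acyclic E → ∀ R {v} → v ∉ R → ∃[ u ] (u ∉ R × Closed R u)
  closed-vertex-outside acyclic R v∉R
    with Fin.any? (λ u → ¬? (∈?[ _≟_ ] u R) ×-dec closed? R u)
  ... | yes found = found
  ... | no none   = contradiction v∉R (acyclic⇒no-endless-walk acyclic (_∉ R) successor)
    where
    successor : ∀ {u} → u ∉ R → ∃[ w ] ((u , w) ∈ E × w ∉ R)
    successor {u} u∉R with closed-or-successor-outside R u
    ... | inj₁ closed = contradiction (u , u∉R , λ {_} → closed) none
    ... | inj₂ found  = found

  TopologicalList⇒Unique : ∀ {R} → TopologicalList R → Unique R
  TopologicalList⇒Unique []                 = []
  TopologicalList⇒Unique (cons _ v∉R topo) =
    All.tabulate (λ w∈R v≡w → v∉R (subst (_∈ _) (sym v≡w) w∈R)) ∷ TopologicalList⇒Unique topo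

  TopologicalList⇒Closed : ∀ {R u} → TopologicalList R → u ∈ R → Closed R u
  TopologicalList⇒Closed (cons closed _ _) (here refl) e = there (closed e)
  TopologicalList⇒Closed (cons _ _ topo)   (there u∈R) e = there (TopologicalList⇒Closed topo u∈R e)

  TopologicalList⇒index< : ∀ {R u w} → TopologicalList R → (p : u ∈ R) (q : w ∈ R) →
                           (u , w) ∈ E → Any.index p < Any.index q
  TopologicalList⇒index< (cons closed v∉R _) (here refl) (here refl) e = contradiction (closed e) v∉R
  TopologicalList⇒index< (cons _ _ _)        (here refl) (there _)   e = z<s
  TopologicalList⇒index< (cons _ v∉R topo)   (there p)   (here refl) e =
    contradiction (TopologicalList⇒Closed topo p e) v∉R
  TopologicalList⇒index< (cons _ _ topo)     (there p)   (there q)   e =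
    s<s (TopologicalList⇒index< topo p q e)

  private
    TopologicalList-complete-or-≥ :
      Acyclic E → ∀ k → ∃[ R ] (TopologicalList R × ((∀ v → v ∈ R) ⊎ k ℕ.≤ length R))
    TopologicalList-complete-or-≥ acyclic zero = [] , [] , inj₂ z≤n
    TopologicalList-complete-or-≥ acyclic (suc k) with TopologicalList-complete-or-≥ acyclic k
    ... | R , topo , inj₁ complete = R , topo , inj₁ complete
    ... | R , topo , inj₂ k≤|R| with Fin.all? (λ v → ∈?[ _≟_ ] v R)
    ...   | yes complete = R , topo , inj₁ complete
    ...   | no incomplete
            with closed-vertex-outside acyclic R (proj₂ (Fin.¬∀⟶∃¬ n _ (λ v → ∈?[ _≟_ ] v R) incomplete))
    ...     | u , u∉R , closed = u ∷ R , cons closed u∉R topo , inj₂ (s≤s k≤|R|)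

  acyclic⇒complete-TopologicalList : Acyclic E → ∃[ R ] (TopologicalList R × (∀ v → v ∈ R))
  acyclic⇒complete-TopologicalList acyclic with TopologicalList-complete-or-≥ acyclic (suc n)
  ... | R , topo , inj₁ complete = R , topo , complete
  ... | R , topo , inj₂ n<|R| =
    contradiction (Fin.injective⇒≤ (lookup-injective (TopologicalList⇒Unique topo) _ _)) (ℕ.<⇒≱ n<|R|)

  acyclic⇒topological : Acyclic E → ∃[ σ ] Topological E σ
  acyclic⇒topological acyclic with acyclic⇒complete-TopologicalList acyclic
  ... | R , topo , complete =
    toPermutation′ (↔⇒≡ σ) σ (λ e → TopologicalList⇒index< topo (complete _) (complete _) e)
    where
    σ : Permutation (length R) n
    σ = permutation (lookup R) (λ v → Any.index (complete v))
          (λ v → sym (lookup-index (complete v)))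
          (λ i → lookup-injective (TopologicalList⇒Unique topo) _ _
                   (sym (lookup-index (complete (lookup R i)))))

    toPermutation′ : ∀ {m} → m ≡ n → (σ : Permutation m n) → Topological E σ → ∃[ σ ] Topological E σ
    toPermutation′ refl σ topo = σ , topo

module _ where

  open import Data.Integer using (_+_; _-_; _≤_)

  -- Entries and column sums

  ZeroOrOne : ℤ → Set
  ZeroOrOne z = (z ≡ 0ℤ) ⊎ (z ≡ 1ℤ)

  Trit : ℤ → Set
  Trit z = (z ≡ 0ℤ) ⊎ ((z ≡ 1ℤ) ⊎ (z ≡ - 1ℤ))

  unitCol-trit : ∀ (v k : Fin n) → Trit (unitCol v k)
  unitCol-trit v k with k ≟ v
  ... | yes _ = inj₂ (inj₁ refl)
  ... | no  _ = inj₁ refl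

  edgeCol-trit : ∀ (e : Edge n) k → Trit (edgeCol e k)
  edgeCol-trit (a , b) k with k ≟ a | k ≟ b
  ... | yes _ | _     = inj₂ (inj₁ refl)
  ... | no  _ | yes _ = inj₂ (inj₂ refl)
  ... | no  _ | no  _ = inj₁ refl

  unitCol-self : ∀ (v : Fin n) → unitCol v v ≡ 1ℤ
  unitCol-self v with v ≟ v
  ... | yes _   = refl
  ... | no v≢v = contradiction refl v≢v

  unitCol-other : ∀ {v k : Fin n} → k ≢ v → unitCol v k ≡ 0ℤ
  unitCol-other {v = v} {k} k≢v with k ≟ v
  ... | yes k≡v = contradiction k≡v k≢v
  ... | no  _   = refl

  0≤unitCol : ∀ (v k : Fin n) → 0ℤ ≤ unitCol v k
  0≤unitCol v k with k ≟ v
  ... | yes _ = +≤+ z≤n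
  ... | no  _ = +≤+ z≤n

  0≤edgeCol : ∀ {a b k : Fin n} → k ≢ b → 0ℤ ≤ edgeCol (a , b) k
  0≤edgeCol {a = a} {b} {k} k≢b with k ≟ a | k ≟ b
  ... | yes _ | _       = +≤+ z≤n
  ... | no  _ | yes k≡b = contradiction k≡b k≢b
  ... | no  _ | no  _   = +≤+ z≤n

  edgeCol≤0 : ∀ {a b k : Fin n} → k ≢ a → edgeCol (a , b) k ≤ 0ℤ
  edgeCol≤0 {a = a} {b} {k} k≢a with k ≟ a | k ≟ b
  ... | yes k≡a | _     = contradiction k≡a k≢a
  ... | no  _   | yes _ = -≤+
  ... | no  _   | no  _ = +≤+ z≤n

  edgeCol≡unitCol-unitCol : ∀ {a b : Fin n} → a ≢ b → ∀ k → edgeCol (a , b) k ≡ unitCol a k - unitCol b k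
  edgeCol≡unitCol-unitCol {a = a} {b} a≢b k with k ≟ a | k ≟ b
  ... | yes refl | yes refl = contradiction refl a≢b
  ... | yes refl | no  _    = refl
  ... | no  _    | yes refl = refl
  ... | no  _    | no  _    = refl

  unitCol-suc : ∀ (v k : Fin n) → unitCol (suc v) (suc k) ≡ unitCol v k
  unitCol-suc v k with v ≟ k
  ... | yes refl = trans (unitCol-self (suc v)) (sym (unitCol-self v))
  ... | no  v≢k  =
    trans (unitCol-other (v≢k ∘ sym ∘ Fin.suc-injective)) (sym (unitCol-other (v≢k ∘ sym)))

  unitCol-⟨$⟩ʳ : ∀ (σ : Permutation′ n) v r → unitCol v (σ ⟨$⟩ʳ r) ≡ unitCol (σ ⟨$⟩ˡ v) r
  unitCol-⟨$⟩ʳ σ v r with r ≟ σ ⟨$⟩ˡ v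
  ... | yes refl = trans (cong (unitCol v) (inverseʳ σ)) (unitCol-self v)
  ... | no  r≢σ⁻¹v = unitCol-other λ σr≡v → r≢σ⁻¹v (trans (sym (inverseˡ σ)) (cong (σ ⟨$⟩ˡ_) σr≡v))

  sumFirst-cong : ∀ i {f g : Fin m → ℤ} → (∀ k → f k ≡ g k) → sumFirst i f ≡ sumFirst i g
  sumFirst-cong zero          f≗g = refl
  sumFirst-cong {m = zero}  (suc i) f≗g = refl
  sumFirst-cong {m = suc m} (suc i) f≗g = cong₂ _+_ (f≗g zero) (sumFirst-cong i (λ k → f≗g (suc k)))

  interchange : ∀ a b c d → (a - b) + (c - d) ≡ (a + c) - (b + d)
  interchange = solve-∀

  sumFirst-zero : ∀ i {f : Fin m → ℤ} → (∀ k → f k ≡ 0ℤ) → sumFirst i f ≡ 0ℤ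
  sumFirst-zero i f≗0 = trans (sumFirst-cong i f≗0) (zeros i)
    where
    zeros : ∀ {m} i → sumFirst {m} i (λ _ → 0ℤ) ≡ 0ℤ
    zeros           zero    = refl
    zeros {zero}  (suc i) = refl
    zeros {suc m} (suc i) = trans (ℤ.+-identityˡ _) (zeros {m} i)

  sumFirst-- : ∀ i (f g : Fin m → ℤ) → sumFirst i (λ k → f k - g k) ≡ sumFirst i f - sumFirst i g
  sumFirst-- zero              f g = refl
  sumFirst-- {m = zero}  (suc i) f g = refl
  sumFirst-- {m = suc m} (suc i) f g = begin
    (f zero - g zero) + sumFirst i (λ k → f (suc k) - g (suc k))
      ≡⟨ cong (λ s → (f zero - g zero) + s) (sumFirst-- i (f ∘ suc) (g ∘ suc)) ⟩
    (f zero - g zero) + (sumFirst i (f ∘ suc) - sumFirst i (g ∘ suc))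
      ≡⟨ interchange (f zero) (g zero) _ _ ⟩
    (f zero + sumFirst i (f ∘ suc)) - (g zero + sumFirst i (g ∘ suc)) ∎
    where open ≡-Reasoning

  sumFirst-unitCol-≤ : ∀ i (p : Fin m) → i ℕ.≤ toℕ p → sumFirst i (unitCol p) ≡ 0ℤ
  sumFirst-unitCol-≤ zero    p       _         = refl
  sumFirst-unitCol-≤ (suc i) (suc p) (s≤s i≤p) =
    trans (ℤ.+-identityˡ _) (trans (sumFirst-cong i (unitCol-suc p)) (sumFirst-unitCol-≤ i p i≤p))

  sumFirst-unitCol-> : ∀ i (p : Fin m) → toℕ p ℕ.< i → sumFirst i (unitCol p) ≡ 1ℤ
  sumFirst-unitCol-> (suc i) zero    _         = cong (λ s → 1ℤ + s) (sumFirst-zero i λ _ → refl)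
  sumFirst-unitCol-> (suc i) (suc p) (s≤s p<i) =
    trans (ℤ.+-identityˡ _) (trans (sumFirst-cong i (unitCol-suc p)) (sumFirst-unitCol-> i p p<i))

  sumFirst-unitCol-01 : ∀ i (p : Fin m) → ZeroOrOne (sumFirst i (unitCol p))
  sumFirst-unitCol-01 i p with toℕ p ℕ.<? i
  ... | yes p<i = inj₂ (sumFirst-unitCol-> i p p<i)
  ... | no  p≮i = inj₁ (sumFirst-unitCol-≤ i p (ℕ.≮⇒≥ p≮i))

  sumFirst-unitCol-unitCol-01 : ∀ i {p q : Fin m} → toℕ p ℕ.< toℕ q →
                                ZeroOrOne (sumFirst i (unitCol p) - sumFirst i (unitCol q))
  sumFirst-unitCol-unitCol-01 i {p} {q} p<q with toℕ q ℕ.<? i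
  ... | yes q<i =
    inj₁ (cong₂ _-_ (sumFirst-unitCol-> i p (ℕ.<-trans p<q q<i)) (sumFirst-unitCol-> i q q<i))
  ... | no  q≮i with toℕ p ℕ.<? i
  ...   | yes p<i =
    inj₂ (cong₂ _-_ (sumFirst-unitCol-> i p p<i) (sumFirst-unitCol-≤ i q (ℕ.≮⇒≥ q≮i)))
  ...   | no  p≮i =
    inj₁ (cong₂ _-_ (sumFirst-unitCol-≤ i p (ℕ.≮⇒≥ p≮i)) (sumFirst-unitCol-≤ i q (ℕ.≮⇒≥ q≮i)))

  module _ (σ : Permutation′ n) where

    unitColumnSum-01 : ∀ v i → ZeroOrOne (sumFirst i (λ r → unitCol v (σ ⟨$⟩ʳ r)))
    unitColumnSum-01 v i =
      subst ZeroOrOne (sym (sumFirst-cong i (unitCol-⟨$⟩ʳ σ v))) (sumFirst-unitCol-01 i (σ ⟨$⟩ˡ v))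

    edgeColumnSum : ∀ {a b} → a ≢ b → ∀ i → sumFirst i (λ r → edgeCol (a , b) (σ ⟨$⟩ʳ r))
                    ≡ sumFirst i (unitCol (σ ⟨$⟩ˡ a)) - sumFirst i (unitCol (σ ⟨$⟩ˡ b))
    edgeColumnSum {a} {b} a≢b i = trans (sumFirst-cong i as-difference) (sumFirst-- i _ _)
      where
      as-difference : ∀ r → edgeCol (a , b) (σ ⟨$⟩ʳ r) ≡ unitCol (σ ⟨$⟩ˡ a) r - unitCol (σ ⟨$⟩ˡ b) r
      as-difference r = trans (edgeCol≡unitCol-unitCol a≢b (σ ⟨$⟩ʳ r))
                              (cong₂ _-_ (unitCol-⟨$⟩ʳ σ a r) (unitCol-⟨$⟩ʳ σ b r))

    edgeColumnSum-01 : ∀ {a b} → a ≢ b → σ ⟨$⟩ˡ a Fin.< σ ⟨$⟩ˡ b →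
                       ∀ i → ZeroOrOne (sumFirst i (λ r → edgeCol (a , b) (σ ⟨$⟩ʳ r)))
    edgeColumnSum-01 a≢b a<b i =
      subst ZeroOrOne (sym (edgeColumnSum a≢b i)) (sumFirst-unitCol-unitCol-01 i a<b)

    edgeColumnSum-reversed : ∀ {a b} → a ≢ b → σ ⟨$⟩ˡ b Fin.< σ ⟨$⟩ˡ a →
                             sumFirst (suc (toℕ (σ ⟨$⟩ˡ b))) (λ r → edgeCol (a , b) (σ ⟨$⟩ʳ r)) ≡ - 1ℤ
    edgeColumnSum-reversed {a} {b} a≢b b<a = trans (edgeColumnSum a≢b (suc (toℕ (σ ⟨$⟩ˡ b))))
      (cong₂ _-_ (sumFirst-unitCol-≤ _ (σ ⟨$⟩ˡ a) b<a) (sumFirst-unitCol-> _ (σ ⟨$⟩ˡ b) ℕ.≤-refl))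

  -- Row sums

  sumℤ : List ℤ → ℤ
  sumℤ = foldr _+_ 0ℤ

  sumℤ-++ : ∀ xs ys → sumℤ (xs ++ ys) ≡ sumℤ xs + sumℤ ys
  sumℤ-++ []       ys = sym (ℤ.+-identityˡ _)
  sumℤ-++ (x ∷ xs) ys = trans (cong (λ s → x + s) (sumℤ-++ xs ys)) (sym (ℤ.+-assoc x _ _))

  sumFirst-lookup : ∀ {A : Set} (g : A → ℤ) (as : List A) j →
                    sumFirst j (λ c → g (lookup as c)) ≡ sumℤ (take j (map g as))
  sumFirst-lookup g []       zero    = refl
  sumFirst-lookup g []       (suc j) = refl
  sumFirst-lookup g (a ∷ as) zero    = refl
  sumFirst-lookup g (a ∷ as) (suc j) = cong (λ s → g a + s) (sumFirst-lookup g as j)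

  sumℤ≤0 : All (_≤ 0ℤ) xs → sumℤ xs ≤ 0ℤ
  sumℤ≤0 []         = ℤ.≤-refl
  sumℤ≤0 (x≤0 ∷ xs≤0) = ℤ.+-mono-≤ x≤0 (sumℤ≤0 xs≤0)

  sumℤ≤sumℤ-take : All (_≤ 0ℤ) xs → ∀ j → sumℤ xs ≤ sumℤ (take j xs)
  sumℤ≤sumℤ-take xs≤0             zero    = sumℤ≤0 xs≤0
  sumℤ≤sumℤ-take []               (suc j) = ℤ.≤-refl
  sumℤ≤sumℤ-take {x ∷ _} (_ ∷ xs≤0) (suc j) = ℤ.+-monoʳ-≤ x (sumℤ≤sumℤ-take xs≤0 j)

  data NonnegThenNonpos : List ℤ → Set where
    nonpos : All (_≤ 0ℤ) xs → NonnegThenNonpos xs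
    _∷_    : 0ℤ ≤ x → NonnegThenNonpos xs → NonnegThenNonpos (x ∷ xs)

  NonnegThenNonpos-++⁺ : All (0ℤ ≤_) xs → NonnegThenNonpos ys → NonnegThenNonpos (xs ++ ys)
  NonnegThenNonpos-++⁺ []           ys = ys
  NonnegThenNonpos-++⁺ (0≤x ∷ 0≤xs) ys = 0≤x ∷ NonnegThenNonpos-++⁺ 0≤xs ys

  prefixSum-nonneg-or-≥total : NonnegThenNonpos xs → ∀ j →
                                (0ℤ ≤ sumℤ (take j xs)) ⊎ (sumℤ xs ≤ sumℤ (take j xs))
  prefixSum-nonneg-or-≥total (nonpos xs≤0) j       = inj₂ (sumℤ≤sumℤ-take xs≤0 j)
  prefixSum-nonneg-or-≥total (0≤x ∷ ntn)   zero    = inj₁ ℤ.≤-refl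
  prefixSum-nonneg-or-≥total {x ∷ _} (0≤x ∷ ntn) (suc j) with prefixSum-nonneg-or-≥total ntn j
  ... | inj₁ 0≤prefix     = inj₁ (ℤ.+-mono-≤ 0≤x 0≤prefix)
  ... | inj₂ total≤prefix = inj₂ (ℤ.+-monoʳ-≤ x total≤prefix)

  prefixSum-nonneg : NonnegThenNonpos xs → 0ℤ ≤ sumℤ xs → ∀ j → 0ℤ ≤ sumℤ (take j xs)
  prefixSum-nonneg ntn 0≤total j =
    [ id , ℤ.≤-trans 0≤total ] (prefixSum-nonneg-or-≥total ntn j)

  edgeRow-NonnegThenNonpos :
    ∀ (rank : Fin n → ℕ) {es : List (Edge n)} →
    AllPairs (λ e f → rank (proj₁ f) ℕ.≤ rank (proj₁ e)) es →
    All (λ e → rank (proj₁ e) ℕ.< rank (proj₂ e)) es →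
    ∀ v → NonnegThenNonpos (map (λ e → edgeCol e v) es)
  edgeRow-NonnegThenNonpos rank []                 []                   v = nonpos []
  edgeRow-NonnegThenNonpos rank {(a , b) ∷ es} (later≤a ∷ sorted) (a<b ∷ increasing) v with b ≟ v
  ... | yes refl = nonpos (edgeCol≤0 (notTail a<b) ∷
                          All.map⁺ (All.map (λ f≤a → edgeCol≤0 (notTail (ℕ.≤-<-trans f≤a a<b))) later≤a))
    where
    notTail : ∀ {t} → rank t ℕ.< rank v → v ≢ t
    notTail t<v refl = ℕ.<-irrefl refl t<v
  ... | no  b≢v  = 0≤edgeCol (b≢v ∘ sym) ∷ edgeRow-NonnegThenNonpos rank sorted increasing v

  unitCol+count-∷ : ∀ {A : Set} (f : A → Fin n) v a as →
                    unitCol (f a) v + + length (filter (λ b → f b ≟ v) as)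
                    ≡ + length (filter (λ b → f b ≟ v) (a ∷ as))
  unitCol+count-∷ f v a as with f a ≟ v
  ... | yes refl = cong (λ x → x + + length (filter (λ b → f b ≟ v) as)) (unitCol-self v)
  ... | no  fa≢v = cong (λ x → x + + length (filter (λ b → f b ≟ v) as)) (unitCol-other (fa≢v ∘ sym))

  edgeRowSum : ∀ v {es : List (Edge n)} → All (λ e → proj₁ e ≢ proj₂ e) es →
               sumℤ (map (λ e → edgeCol e v) es) ≡ + outdeg es v - + indeg es v
  edgeRowSum v []                               = refl
  edgeRowSum v {(a , b) ∷ es} (a≢b ∷ loopless) = begin
    edgeCol (a , b) v + sumℤ (map (λ e → edgeCol e v) es)
      ≡⟨ cong₂ _+_ (edgeCol≡unitCol-unitCol a≢b v) (edgeRowSum v loopless) ⟩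
    (unitCol a v - unitCol b v) + (+ outdeg es v - + indeg es v)
      ≡⟨ interchange (unitCol a v) (unitCol b v) _ _ ⟩
    (unitCol a v + + outdeg es v) - (unitCol b v + + indeg es v)
      ≡⟨ cong₂ _-_ (unitCol+count-∷ proj₁ v (a , b) es) (unitCol+count-∷ proj₂ v (a , b) es) ⟩
    + outdeg ((a , b) ∷ es) v - + indeg ((a , b) ∷ es) v ∎
    where open ≡-Reasoning

  unitRowSum-∉ : ∀ {v : Fin n} ss → v ∉ ss → sumℤ (map (λ s → unitCol s v) ss) ≡ 0ℤ
  unitRowSum-∉ []       v∉ss = refl
  unitRowSum-∉ (s ∷ ss) v∉ss =
    cong₂ _+_ (unitCol-other (v∉ss ∘ here)) (unitRowSum-∉ ss (v∉ss ∘ there))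

  unitRowSum-∈ : ∀ {v : Fin n} {ss} → Unique ss → v ∈ ss → sumℤ (map (λ s → unitCol s v) ss) ≡ 1ℤ
  unitRowSum-∈ {ss = s ∷ ss} (s∉ss ∷ _) (here refl) =
    cong₂ _+_ (unitCol-self s) (unitRowSum-∉ ss (λ s∈ss → All.lookup s∉ss s∈ss refl))
  unitRowSum-∈ {v = v} {ss = s ∷ _} (s∉ss ∷ unique) (there v∈ss) =
    cong₂ _+_ (unitCol-other {v = s} {k = v} λ { refl → All.lookup s∉ss v∈ss refl })
              (unitRowSum-∈ unique v∈ss)

  -- The generalized incidence matrix

  columns : List (Fin n) → List (Edge n) → List (Column n)
  columns ss es = map unitCol ss ++ map edgeCol es

  row-columns : ∀ ss (es : List (Edge n)) v →
                map (λ col → col v) (columns ss es)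
                ≡ map (λ s → unitCol s v) ss ++ map (λ e → edgeCol e v) es
  row-columns ss es v = trans (map-++ (λ col → col v) (map unitCol ss) (map edgeCol es))
                              (cong₂ _++_ (sym (map-∘ ss)) (sym (map-∘ es)))

  lookup-columns : ∀ ss (es : List (Edge n)) c →
                   (∃[ s ] lookup (columns ss es) c ≡ unitCol s) ⊎
                   (∃[ e ] (e ∈ es × lookup (columns ss es) c ≡ edgeCol e))
  lookup-columns ss es c with ∈-++⁻ (map unitCol ss) (∈-lookup {xs = columns ss es} c)
  ... | inj₁ ∈units = let s , _ , eq = ∈-map⁻ unitCol ∈units in inj₁ (s , eq)
  ... | inj₂ ∈edges = let e , e∈es , eq = ∈-map⁻ edgeCol ∈edges in inj₂ (e , e∈es , eq)

  sumFirst-lookup-length : ∀ {A : Set} (g : A → ℤ) (as : List A) →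
                           sumFirst (length as) (λ c → g (lookup as c)) ≡ sumℤ (map g as)
  sumFirst-lookup-length g as = trans (sumFirst-lookup g as (length as))
    (cong sumℤ (take-all (length as) (map g as) (ℕ.≤-reflexive (length-map g as))))

  DegreeCondition : List (Edge n) → Subset n → Fin n → Set
  DegreeCondition E S v = indeg E v ℕ.≤ outdeg E v ℕ.+ 1 × (indeg E v ≡ outdeg E v ℕ.+ 1 → v ∈ₛ S)

  0≤u+[o-i]⇔i≤u+o : ∀ u o i → 0ℤ ≤ + u + (+ o - + i) ⇔ i ℕ.≤ u ℕ.+ o
  0≤u+[o-i]⇔i≤u+o u o i = mk⇔
    (λ 0≤ → ℤ.drop‿+≤+ (ℤ.0≤i-j⇒j≤i (subst (0ℤ ≤_) (reassoc (+ u) (+ o) (+ i)) 0≤)))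
    (λ i≤ → subst (0ℤ ≤_) (sym (reassoc (+ u) (+ o) (+ i))) (ℤ.i≤j⇒0≤j-i (+≤+ i≤)))
    where
    reassoc : ∀ a b c → a + (b - c) ≡ (a + b) - c
    reassoc = solve-∀

  rowTotal : ∀ {E es : List (Edge n)} ss → es ↭ E → All (λ e → proj₁ e ≢ proj₂ e) E → ∀ v →
             sumℤ (map (λ col → col v) (columns ss es))
             ≡ sumℤ (map (λ s → unitCol s v) ss) + (+ outdeg E v - + indeg E v)
  rowTotal {E = E} {es} ss es↭E loopless v = begin
    sumℤ (map (λ col → col v) (columns ss es))
      ≡⟨ cong sumℤ (row-columns ss es v) ⟩
    sumℤ (map (λ s → unitCol s v) ss ++ map (λ e → edgeCol e v) es)
      ≡⟨ sumℤ-++ (map (λ s → unitCol s v) ss) _ ⟩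
    sumℤ (map (λ s → unitCol s v) ss) + sumℤ (map (λ e → edgeCol e v) es)
      ≡⟨ cong (λ x → sumℤ (map (λ s → unitCol s v) ss) + x) edges ⟩
    sumℤ (map (λ s → unitCol s v) ss) + (+ outdeg E v - + indeg E v) ∎
    where
    open ≡-Reasoning
    edges : sumℤ (map (λ e → edgeCol e v) es) ≡ + outdeg E v - + indeg E v
    edges = trans (edgeRowSum v (All-resp-↭ (↭-sym es↭E) loopless))
                  (cong₂ (λ o i → + o - + i) (↭-length (filter-↭ (λ e → proj₁ e ≟ v) es↭E))
                                              (↭-length (filter-↭ (λ e → proj₂ e ≟ v) es↭E)))

  0≤-cong : ∀ {x y} → x ≡ y → 0ℤ ≤ x ⇔ 0ℤ ≤ y
  0≤-cong x≡y = mk⇔ (subst (0ℤ ≤_) x≡y) (subst (0ℤ ≤_) (sym x≡y))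

  rowTotal-nonneg⇔DegreeCondition :
    ∀ {E es : List (Edge n)} {S ss} → Unique ss → (∀ v → v ∈ ss ⇔ v ∈ₛ S) → es ↭ E →
    All (λ e → proj₁ e ≢ proj₂ e) E →
    ∀ v → 0ℤ ≤ sumℤ (map (λ col → col v) (columns ss es)) ⇔ DegreeCondition E S v
  rowTotal-nonneg⇔DegreeCondition {E = E} {es} {S} {ss} unique ss≈S es↭E loopless v with ∈?[ _≟_ ] v ss
  ... | yes v∈ss =
    ⇔.trans (0≤-cong (trans (rowTotal ss es↭E loopless v) (cong (λ u → u + _) (unitRowSum-∈ unique v∈ss))))
            (⇔.trans (0≤u+[o-i]⇔i≤u+o 1 _ _) (mk⇔ to from))
    where
    to : indeg E v ℕ.≤ 1 ℕ.+ outdeg E v → DegreeCondition E S v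
    to i≤1+o = subst (indeg E v ℕ.≤_) (ℕ.+-comm 1 _) i≤1+o , λ _ → Equivalence.to (ss≈S v) v∈ss
    from : DegreeCondition E S v → indeg E v ℕ.≤ 1 ℕ.+ outdeg E v
    from (i≤o+1 , _) = subst (indeg E v ℕ.≤_) (ℕ.+-comm _ 1) i≤o+1
  ... | no  v∉ss =
    ⇔.trans (0≤-cong (trans (rowTotal ss es↭E loopless v) (cong (λ u → u + _) (unitRowSum-∉ ss v∉ss))))
            (⇔.trans (0≤u+[o-i]⇔i≤u+o 0 _ _) (mk⇔ to from))
    where
    o+1≡1+o : outdeg E v ℕ.+ 1 ≡ suc (outdeg E v)
    o+1≡1+o = ℕ.+-comm _ 1
    to : indeg E v ℕ.≤ outdeg E v → DegreeCondition E S v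
    to i≤o = ℕ.m≤n⇒m≤n+o 1 i≤o ,
             λ i≡o+1 → contradiction (subst (ℕ._≤ outdeg E v) (trans i≡o+1 o+1≡1+o) i≤o) ℕ.1+n≰n
    from : DegreeCondition E S v → indeg E v ℕ.≤ outdeg E v
    from (i≤o+1 , i≡o+1⇒v∈S) = ℕ.m<1+n⇒m≤n (subst (indeg E v ℕ.<_) o+1≡1+o
      (ℕ.≤∧≢⇒< i≤o+1 (λ i≡o+1 → v∉ss (Equivalence.from (ss≈S v) (i≡o+1⇒v∈S i≡o+1)))))

  module _ {E es : List (Edge n)} {σ : Permutation′ n} {ss : List (Fin n)}
           (loopless : All (λ e → proj₁ e ≢ proj₂ e) E) (es↭E : es ↭ E)
           (srm : IsSRM (genIncMatrix σ ss es)) where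

    open IsSRM srm

    -- The prefix of the edge's column ending at the head's row would sum to -1.
    IsSRM⇒tail-before-head : ∀ {u w} → (u , w) ∈ E → ¬ (σ ⟨$⟩ˡ w Fin.< σ ⟨$⟩ˡ u)
    IsSRM⇒tail-before-head {u} {w} e∈E w<u
      with subst ZeroOrOne prefix≡-1 (colSums c throughHead)
      where
      col∈ : edgeCol (u , w) ∈ columns ss es
      col∈ = ∈-++⁺ʳ (map unitCol ss) (∈-map⁺ edgeCol (∈-resp-↭ (↭-sym es↭E) e∈E))
      c : Fin (length (columns ss es))
      c = Any.index col∈
      throughHead : ℕ
      throughHead = suc (toℕ (σ ⟨$⟩ˡ w))
      prefix≡-1 : sumFirst throughHead (λ r → genIncMatrix σ ss es r c) ≡ - 1ℤ
      prefix≡-1 = trans (sumFirst-cong throughHead λ r → cong-app (sym (lookup-index col∈)) (σ ⟨$⟩ʳ r))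
                        (edgeColumnSum-reversed σ (All.lookup loopless e∈E) w<u)
    ... | inj₁ ()
    ... | inj₂ ()

    IsSRM⇒topological : Topological E σ
    IsSRM⇒topological {u} {w} e∈E with Fin.<-cmp (σ ⟨$⟩ˡ u) (σ ⟨$⟩ˡ w)
    ... | tri< u<w _ _ = u<w
    ... | tri≈ _ same _ =
      contradiction (trans (sym (inverseʳ σ)) (trans (cong (σ ⟨$⟩ʳ_) same) (inverseʳ σ))) (All.lookup loopless e∈E)
    ... | tri> _ _ w<u = contradiction w<u (IsSRM⇒tail-before-head e∈E)

    IsSRM⇒DegreeCondition : ∀ {S} → Unique ss → (∀ v → v ∈ ss ⇔ v ∈ₛ S) → ∀ v → DegreeCondition E S v
    IsSRM⇒DegreeCondition unique ss≈S v =
      Equivalence.to (rowTotal-nonneg⇔DegreeCondition unique ss≈S es↭E loopless v)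
                     (subst (0ℤ ≤_) full-row (rowSums (σ ⟨$⟩ˡ v) (length (columns ss es))))
      where
      full-row : sumFirst (length (columns ss es)) (λ c → genIncMatrix σ ss es (σ ⟨$⟩ˡ v) c)
                 ≡ sumℤ (map (λ col → col v) (columns ss es))
      full-row = trans (sumFirst-lookup-length (λ col → col (σ ⟨$⟩ʳ (σ ⟨$⟩ˡ v))) (columns ss es))
                       (cong (λ x → sumℤ (map (λ col → col x) (columns ss es))) (inverseʳ σ))

  module Construction {E : List (Edge n)} (loopless : All (λ e → proj₁ e ≢ proj₂ e) E)
                      (σ : Permutation′ n) (topological : Topological E σ) where

    rank : Fin n → ℕ
    rank v = toℕ (σ ⟨$⟩ˡ v)

    byDecreasingTailRank : DecTotalOrder 0ℓ 0ℓ 0ℓ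
    byDecreasingTailRank =
      On.decTotalOrder (Flip.decTotalOrder ℕ.≤-decTotalOrder) (λ (e : Edge n) → rank (proj₁ e))

    open import Data.List.Sort byDecreasingTailRank using (sort; sort-↭; sort-↗)

    sortedEdges : List (Edge n)
    sortedEdges = sort E

    sortedEdges↭E : sortedEdges ↭ E
    sortedEdges↭E = sort-↭ E

    private
      sorted : AllPairs (λ e f → rank (proj₁ f) ℕ.≤ rank (proj₁ e)) sortedEdges
      sorted = Sorted⇒AllPairs (DecTotalOrder.totalOrder byDecreasingTailRank) (sort-↗ E)

      increasing : All (λ e → rank (proj₁ e) ℕ.< rank (proj₂ e)) sortedEdges
      increasing = All-resp-↭ (↭-sym sortedEdges↭E) (All.tabulate topological)

    DegreeCondition⇒IsSRM : ∀ {S ss} → Unique ss → (∀ v → v ∈ ss ⇔ v ∈ₛ S) →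
                            (∀ v → DegreeCondition E S v) → IsSRM (genIncMatrix σ ss sortedEdges)
    DegreeCondition⇒IsSRM {ss = ss} unique ss≈S degree = record
      { entries = entries
      ; colSums = colSums
      ; rowSums = rowSums
      }
      where
      entries : ∀ r c → Trit (genIncMatrix σ ss sortedEdges r c)
      entries r c with lookup-columns ss sortedEdges c
      ... | inj₁ (s , col≡)     = subst Trit (sym (cong-app col≡ (σ ⟨$⟩ʳ r))) (unitCol-trit s (σ ⟨$⟩ʳ r))
      ... | inj₂ (e , _ , col≡) = subst Trit (sym (cong-app col≡ (σ ⟨$⟩ʳ r))) (edgeCol-trit e (σ ⟨$⟩ʳ r))

      colSums : ∀ c i → ZeroOrOne (sumFirst i (λ r → genIncMatrix σ ss sortedEdges r c))
      colSums c i with lookup-columns ss sortedEdges c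
      ... | inj₁ (s , col≡) =
        subst ZeroOrOne (sumFirst-cong i λ r → sym (cong-app col≡ (σ ⟨$⟩ʳ r))) (unitColumnSum-01 σ s i)
      ... | inj₂ (e , e∈ , col≡) =
        subst ZeroOrOne (sumFirst-cong i λ r → sym (cong-app col≡ (σ ⟨$⟩ʳ r)))
              (edgeColumnSum-01 σ (All.lookup loopless e∈E) (topological e∈E) i)
        where
        e∈E : e ∈ E
        e∈E = ∈-resp-↭ sortedEdges↭E e∈

      rowSums : ∀ r j → 0ℤ ≤ sumFirst j (λ c → genIncMatrix σ ss sortedEdges r c)
      rowSums r j = subst (0ℤ ≤_) (sym (sumFirst-lookup (λ col → col v) (columns ss sortedEdges) j))
                          (prefixSum-nonneg row total j)
        where
        v : Fin n
        v = σ ⟨$⟩ʳ r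
        row : NonnegThenNonpos (map (λ col → col v) (columns ss sortedEdges))
        row = subst NonnegThenNonpos (sym (row-columns ss sortedEdges v))
                (NonnegThenNonpos-++⁺ (All.map⁺ (All.universal (λ s → 0≤unitCol s v) ss))
                                      (edgeRow-NonnegThenNonpos rank sorted increasing v))
        total : 0ℤ ≤ sumℤ (map (λ col → col v) (columns ss sortedEdges))
        total = Equivalence.from (rowTotal-nonneg⇔DegreeCondition unique ss≈S sortedEdges↭E loopless v)
                                 (degree v)

open import Data.Nat using (_+_; _≤_)

module _ {n} (S : Subset n) where

  membersOf : List (Fin n)
  membersOf = filter (_∈ₛ? S) (allFin n)

  membersOf-unique : Unique membersOf
  membersOf-unique = Unique.filter⁺ (_∈ₛ? S) (Unique.allFin⁺ n)

  ∈membersOf⇔∈ : ∀ v → v ∈ membersOf ⇔ v ∈ₛ S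
  ∈membersOf⇔∈ v =
    mk⇔ (λ v∈ → proj₂ (∈-filter⁻ (_∈ₛ? S) {xs = allFin n} v∈)) (∈-filter⁺ (_∈ₛ? S) (∈-allFin v))

theorem2p5 : (n : ℕ) (E : List (Edge n)) → Unique E → All (λ e → proj₁ e ≢ proj₂ e) E → E ≢ []
    → (S : Subset n)
    → (∃[ σ ] ∃[ ss ] ∃[ es ] (Unique ss × (∀ v → (v ∈ ss) ⇔ (v ∈ₛ S)) × (es ↭ E) × IsSRM (genIncMatrix σ ss es)))
      ⇔ (Acyclic E × (∀ v → indeg E v ≤ outdeg E v + 1) × (∀ v → indeg E v ≡ outdeg E v + 1 → v ∈ₛ S))
theorem2p5 n E _ loopless _ S = mk⇔
  (λ (σ , ss , es , unique , ss≈S , es↭E , srm) →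
    let degree = IsSRM⇒DegreeCondition {σ = σ} {ss} loopless es↭E srm unique ss≈S
    in  topological⇒acyclic σ (IsSRM⇒topological {σ = σ} {ss} loopless es↭E srm) ,
        proj₁ ∘ degree , proj₂ ∘ degree)
  (λ (acyclic , indeg≤ , indeg≡⇒∈S) →
    let σ , topological = acyclic⇒topological acyclic
        open Construction loopless σ topological
    in  σ , membersOf S , sortedEdges , membersOf-unique S , ∈membersOf⇔∈ S , sortedEdges↭E ,
        DegreeCondition⇒IsSRM (membersOf-unique S) (∈membersOf⇔∈ S) (λ v → indeg≤ v , indeg≡⇒∈S v))
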